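{- Let $G$ be a non-complete Cayley graph of odd order $n$ whose clique number $\omega$ satisfies $\omega>\frac{n}{3}$. Then $G$ is not of type I, i.e. $\chi''(G)\neq\Delta+1$, where $\Delta$ is the degree of $G$.
   Context: For a finite group $H$ and a subset $S\subseteq H$ with $S=S^{ -1}$ and identity $\notin S$, the Cayley graph has vertex set $H$ and edges $\{g,gs\}$ for $g\in H$, $s\in S$; it is $|S|$-regular. A total coloring of a simple graph is an assignment of colors to vertices and edges such that adjacent vertices, adjacent edges, and an edge and its endpoints all receive different colors; $\chi''(G)$ is the minimum number of colors in a total coloring. A graph with maximum degree $\Delta$ is of type I if $\chi''(G)=\Delta+1$. -}

module Defs where

open import Data.Nat using (ℕ; zero; suc; _⊔_; _≤_)
open import Data.Fin using (Fin)
open import Data.Fin.Subset using (Subset; _∈_; _∉_; ∣_∣)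
open import Data.Fin.Subset.Properties using (_∈?_)
open import Data.Fin.Properties using (_≟_)
open import Data.List using (List; length; filter; map; foldr)
open import Data.List using () renaming (allFin to allFinL)
open import Data.Product using (Σ; ∃; _×_; _,_)
open import Relation.Nullary using (¬_; Dec)
open import Relation.Nullary.Decidable using (_×-dec_)
open import Data.Fin.Properties using (any?)
open import Relation.Binary.PropositionalEquality using (_≡_; _≢_)
open import Algebra.Core using (Op₁; Op₂)
open import Algebra.Structures using (IsGroup)

-- Finite groups of order n, with carrier Fin n (every finite group of
-- order n is isomorphic to one of these).

record FinGroup (n : ℕ) : Set where
  field
    _∙_     : Op₂ (Fin n)
    ε       : Fin n
    _⁻¹     : Op₁ (Fin n)
    isGroup : IsGroup _≡_ _∙_ ε _⁻¹

record Graph (n : ℕ) : Set₁ where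
  field
    Adj    : Fin n → Fin n → Set
    adj?   : ∀ x y → Dec (Adj x y)
    sym    : ∀ {x y} → Adj x y → Adj y x
    irrefl : ∀ {x} → ¬ Adj x x

module _ {n : ℕ} (G : Graph n) where
  open Graph G

  degree : Fin n → ℕ
  degree v = length (filter (adj? v) (allFinL n))

  maxDegree : ℕ
  maxDegree = foldr _⊔_ 0 (map degree (allFinL n))

  Complete : Set
  Complete = ∀ x y → x ≢ y → Adj x y

  IsClique : Subset n → Set
  IsClique K = ∀ x y → x ∈ K → y ∈ K → x ≢ y → Adj x y

  IsCliqueNumber : ℕ → Set
  IsCliqueNumber ω =
    (Σ (Subset n) λ K → IsClique K × ∣ K ∣ ≡ ω) ×
    (∀ K → IsClique K → ∣ K ∣ ≤ ω)

  -- A total coloring with k colors: vertex colours vc, edge colours ec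
  -- (ec x y is the colour of the edge {x,y}; values on non-edges unused).
  record TotalColoring (k : ℕ) : Set where
    field
      vc      : Fin n → Fin k
      ec      : Fin n → Fin n → Fin k
      ec-sym  : ∀ x y → Adj x y → ec x y ≡ ec y x
      vv      : ∀ x y → Adj x y → vc x ≢ vc y
      ee      : ∀ x y z → Adj x y → Adj x z → y ≢ z → ec x y ≢ ec x z
      ev      : ∀ x y → Adj x y → ec x y ≢ vc x

  IsTotalChromaticNumber : ℕ → Set
  IsTotalChromaticNumber c =
    TotalColoring c × (∀ k → TotalColoring k → c ≤ k)

  TypeI : Set
  TypeI = IsTotalChromaticNumber (suc maxDegree)

module _ {n : ℕ} (H : FinGroup n) where
  open FinGroup H

  IsConnectionSet : Subset n → Set
  IsConnectionSet S = (∀ s → s ∈ S → (s ⁻¹) ∈ S) × ε ∉ S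

  CayleyAdj : Subset n → Fin n → Fin n → Set
  CayleyAdj S g h = ∃ λ s → s ∈ S × h ≡ g ∙ s

IsCayleyGraphOf : {n : ℕ} → Graph n → (H : FinGroup n) → Subset n → Set
IsCayleyGraphOf G H S =
  ∀ x y → (Graph.Adj G x y → CayleyAdj H S x y) × (CayleyAdj H S x y → Graph.Adj G x y)

-- In a total colouring of a d-regular graph with d + 1 colours, every vertex v sees all colours:
-- the colour of v and the d colours of its edges. So at every vertex not coloured c exactly one
-- edge has colour c, and the c-edges form a perfect matching of the vertices not coloured c.
-- As G is not complete, n ≥ d + 2, so some colour class has at least two vertices; were it exactly
-- two, n would be even. Hence some colour class contains three pairwise non-adjacent vertices.
-- In a Cayley graph the left translates x K of a maximum clique K are cliques, each vertex lies in
-- exactly ω of them, and each contains at most one of the three vertices; hence 3 ω ≤ n.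

module Submission where

open import Defs
open import Level using (Level; 0ℓ)
open import Function using (_∘_; id)
open import Function.Definitions using (Injective)
open import Data.Bool using (true; false; if_then_else_)
open import Data.Nat using (ℕ; zero; suc; _+_; _*_; _%_; _<_; _≤_; _⊔_; z≤n; s≤s)
import Data.Nat.Properties as ℕ
open import Data.Nat.Divisibility using (_∣_; divides; n∣m⇒m%n≡0)
open import Data.Fin using (Fin; zero; suc; toℕ)
import Data.Fin.Properties as Fin
open import Data.Fin.Subset using (Subset; inside; outside; ∣_∣; _∈_)
open import Data.Fin.Subset.Properties using (_∈?_)
open import Data.List using ([]; _∷_; length; filter; map; foldr; tabulate)
open import Data.Vec using ([]; _∷_)
open import Data.Product using (∃; _×_; _,_; proj₁; proj₂; uncurry)
open import Data.Sum using (_⊎_; inj₁; inj₂; [_,_])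
open import Data.Empty using (⊥-elim)
open import Relation.Nullary using (¬_; yes; no; does; contradiction)
open import Relation.Nullary.Decidable using (_×-dec_; ¬?; _→-dec_)
open import Relation.Unary using (Pred; Decidable; ∁; _⊥_)
open import Relation.Unary.Properties using (∁?; _∪?_)
open import Relation.Binary.PropositionalEquality
  using (_≡_; _≢_; refl; sym; trans; cong; subst; subst₂; module ≡-Reasoning)
open import Algebra.Bundles using (Group)
open import Algebra.Structures using (IsGroup)
import Algebra.Properties.Group as GroupProperties

private
  variable
    p q : Level
    m n k d : ℕ

count : ∀ {n} {P : Pred (Fin n) p} → Decidable P → ℕ
count {n = zero}  P? = 0
count {n = suc n} P? =
  if does (P? zero) then suc (count (P? ∘ suc)) else count (P? ∘ suc)

count≤n : ∀ {n} {P : Pred (Fin n) p} (P? : Decidable P) → count P? ≤ n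
count≤n {n = zero}  P? = z≤n
count≤n {n = suc n} P? with P? zero
... | yes _ = s≤s (count≤n (P? ∘ suc))
... | no  _ = ℕ.m≤n⇒m≤1+n (count≤n (P? ∘ suc))

count+count-∁≡n : ∀ {n} {P : Pred (Fin n) p} (P? : Decidable P) →
                  count P? + count (∁? P?) ≡ n
count+count-∁≡n {n = zero}  P? = refl
count+count-∁≡n {n = suc n} P? with P? zero
... | yes _ = cong suc (count+count-∁≡n (P? ∘ suc))
... | no  _ = trans (ℕ.+-suc _ _) (cong suc (count+count-∁≡n (P? ∘ suc)))

count-cong : ∀ {n} {P : Pred (Fin n) p} {Q : Pred (Fin n) q}
             (P? : Decidable P) (Q? : Decidable Q) →
             (∀ x → does (P? x) ≡ does (Q? x)) → count P? ≡ count Q?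
count-cong {n = zero}  P? Q? same = refl
count-cong {n = suc n} P? Q? same
  rewrite same zero | count-cong (P? ∘ suc) (Q? ∘ suc) (same ∘ suc) = refl

count-∪ : ∀ {n} {P : Pred (Fin n) p} {Q : Pred (Fin n) q}
          (P? : Decidable P) (Q? : Decidable Q) →
          P ⊥ Q → count P? + count Q? ≤ count (P? ∪? Q?)
count-∪ {n = zero}  P? Q? P⊥Q = z≤n
count-∪ {n = suc n} P? Q? P⊥Q with P? zero | Q? zero
... | yes p₀ | yes q₀ = ⊥-elim (P⊥Q (p₀ , q₀))
... | yes _  | no  _  = s≤s (count-∪ (P? ∘ suc) (Q? ∘ suc) P⊥Q)
... | no  _  | yes _  =
  ℕ.≤-trans (ℕ.≤-reflexive (ℕ.+-suc _ _)) (s≤s (count-∪ (P? ∘ suc) (Q? ∘ suc) P⊥Q))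
... | no  _  | no  _  = count-∪ (P? ∘ suc) (Q? ∘ suc) P⊥Q

enumerate : ∀ {n} {P : Pred (Fin n) p} (P? : Decidable P) → Fin (count P?) → Fin n
enumerate {n = suc n} P? i with P? zero
enumerate {n = suc n} P? zero    | yes _ = zero
enumerate {n = suc n} P? (suc i) | yes _ = suc (enumerate (P? ∘ suc) i)
enumerate {n = suc n} P? i       | no  _ = suc (enumerate (P? ∘ suc) i)

enumerate-∈ : ∀ {n} {P : Pred (Fin n) p} (P? : Decidable P) (i : Fin (count P?)) →
              P (enumerate P? i)
enumerate-∈ {n = suc n} P? i with P? zero
enumerate-∈ {n = suc n} P? zero    | yes p₀ = p₀
enumerate-∈ {n = suc n} P? (suc i) | yes _  = enumerate-∈ (P? ∘ suc) i
enumerate-∈ {n = suc n} P? i       | no  _  = enumerate-∈ (P? ∘ suc) i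

enumerate-injective : ∀ {n} {P : Pred (Fin n) p} (P? : Decidable P) →
                      Injective _≡_ _≡_ (enumerate P?)
enumerate-injective {n = suc n} P? {i} {j} eq with P? zero
enumerate-injective {n = suc n} P? {zero}  {zero}  eq | yes _ = refl
enumerate-injective {n = suc n} P? {suc i} {suc j} eq | yes _ =
  cong suc (enumerate-injective (P? ∘ suc) (Fin.suc-injective eq))
enumerate-injective {n = suc n} P? {i}     {j}     eq | no  _ =
  enumerate-injective (P? ∘ suc) (Fin.suc-injective eq)

index : ∀ {n} {P : Pred (Fin n) p} (P? : Decidable P) {x : Fin n} → P x → Fin (count P?)
index {n = suc n} P? {x} px with P? zero
index {n = suc n} P? {zero}  px | yes _ = zero
index {n = suc n} P? {suc x} px | yes _ = suc (index (P? ∘ suc) px)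
index {n = suc n} P? {zero}  px | no ¬p₀ = contradiction px ¬p₀
index {n = suc n} P? {suc x} px | no _  = index (P? ∘ suc) px

enumerate-index : ∀ {n} {P : Pred (Fin n) p} (P? : Decidable P) {x : Fin n} (px : P x) →
                  enumerate P? (index P? px) ≡ x
enumerate-index {n = suc n} P? {x} px with P? zero
enumerate-index {n = suc n} P? {zero}  px | yes _ = refl
enumerate-index {n = suc n} P? {suc x} px | yes _ = cong suc (enumerate-index (P? ∘ suc) px)
enumerate-index {n = suc n} P? {zero}  px | no ¬p₀ = contradiction px ¬p₀
enumerate-index {n = suc n} P? {suc x} px | no _  = cong suc (enumerate-index (P? ∘ suc) px)

injective⇒≤count : ∀ {n} {P : Pred (Fin n) p} (P? : Decidable P) (f : Fin m → Fin n) →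
                   Injective _≡_ _≡_ f → (∀ i → P (f i)) → m ≤ count P?
injective⇒≤count P? f f-injective f∈P =
  Fin.injective⇒≤ {f = λ i → index P? (f∈P i)} λ {i} {j} eq → f-injective (begin
    f i                             ≡⟨ enumerate-index P? (f∈P i) ⟨
    enumerate P? (index P? (f∈P i)) ≡⟨ cong (enumerate P?) eq ⟩
    enumerate P? (index P? (f∈P j)) ≡⟨ enumerate-index P? (f∈P j) ⟩
    f j                             ∎)
  where open ≡-Reasoning

injective-missing-two⇒2+m≤k : (f : Fin m → Fin k) → Injective _≡_ _≡_ f →
                              {a b : Fin k} → a ≢ b →
                              (∀ i → f i ≢ a) → (∀ i → f i ≢ b) → 2 + m ≤ k
injective-missing-two⇒2+m≤k {m} {k} f f-injective {a} {b} a≢b f≢a f≢b = begin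
  2 + m                       ≤⟨ ℕ.+-mono-≤ 2≤count m≤count-∁ ⟩
  count ab? + count (∁? ab?)  ≡⟨ count+count-∁≡n ab? ⟩
  k                           ∎
  where
  open ℕ.≤-Reasoning
  ab? : Decidable (λ x → x ≡ a ⊎ x ≡ b)
  ab? = (Fin._≟ a) ∪? (Fin._≟ b)
  1≤count : (c : Fin k) → 1 ≤ count (Fin._≟ c)
  1≤count c =
    injective⇒≤count (Fin._≟ c) (λ _ → c) (λ { {zero} {zero} _ → refl }) (λ _ → refl)
  2≤count : 2 ≤ count ab?
  2≤count = ℕ.≤-trans (ℕ.+-mono-≤ (1≤count a) (1≤count b))
    (count-∪ (Fin._≟ a) (Fin._≟ b) (λ (x≡a , x≡b) → a≢b (trans (sym x≡a) x≡b)))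
  m≤count-∁ : m ≤ count (∁? ab?)
  m≤count-∁ = injective⇒≤count (∁? ab?) f f-injective (λ i → [ f≢a i , f≢b i ])

-- The points moved forwards by τ and those moved backwards are exchanged by τ.
fixedPointFree-involution⇒even : (τ : Fin n → Fin n) → (∀ x → τ (τ x) ≡ x) →
                                 (∀ x → τ x ≢ x) → 2 ∣ n
fixedPointFree-involution⇒even {n} τ τ∘τ≡id τx≢x = divides (count forward?) (begin
  n                                     ≡⟨ count+count-∁≡n forward? ⟨
  count forward? + count (∁? forward?)  ≡⟨ cong (count forward? +_) backward≡forward ⟩
  count forward? + count forward?       ≡⟨ cong (count forward? +_) (ℕ.+-identityʳ _) ⟨
  2 * count forward?                    ≡⟨ ℕ.*-comm 2 (count forward?) ⟩
  count forward? * 2                    ∎)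
  where
  open ≡-Reasoning
  forward? : Decidable (λ x → toℕ x < toℕ (τ x))
  forward? x = toℕ x ℕ.<? toℕ (τ x)

  τ-injective : Injective _≡_ _≡_ τ
  τ-injective {x} {y} eq = trans (sym (τ∘τ≡id x)) (trans (cong τ eq) (τ∘τ≡id y))

  τ-flips-forward : ∀ x → toℕ x < toℕ (τ x) → ¬ (toℕ (τ x) < toℕ (τ (τ x)))
  τ-flips-forward x x<τx rewrite τ∘τ≡id x = Fin.<-asym x<τx

  τ-flips-backward : ∀ x → ¬ (toℕ x < toℕ (τ x)) → toℕ (τ x) < toℕ (τ (τ x))
  τ-flips-backward x x≮τx rewrite τ∘τ≡id x = Fin.≤∧≢⇒< (ℕ.≮⇒≥ x≮τx) (τx≢x x)

  backward≡forward : count (∁? forward?) ≡ count forward?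
  backward≡forward = ℕ.≤-antisym
    (injective⇒≤count forward? (τ ∘ enumerate (∁? forward?))
      (enumerate-injective (∁? forward?) ∘ τ-injective)
      (λ i → τ-flips-backward _ (enumerate-∈ (∁? forward?) i)))
    (injective⇒≤count (∁? forward?) (τ ∘ enumerate forward?)
      (enumerate-injective forward? ∘ τ-injective)
      (λ i → τ-flips-forward _ (enumerate-∈ forward? i)))

∣p∣≡count : (p : Subset n) → ∣ p ∣ ≡ count (_∈? p)
∣p∣≡count []            = refl
∣p∣≡count (inside  ∷ p) = cong suc (trans (∣p∣≡count p) (count-cong (_∈? p) _ (λ _ → refl)))
∣p∣≡count (outside ∷ p) = trans (∣p∣≡count p) (count-cong (_∈? p) _ (λ _ → refl))

length-filter-tabulate : {A : Set} {P : Pred A p} (P? : Decidable P) (f : Fin n → A) →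
                         length (filter P? (tabulate f)) ≡ count (P? ∘ f)
length-filter-tabulate {n = zero}  P? f = refl
length-filter-tabulate {n = suc n} P? f with does (P? (f zero))
... | true  = cong suc (length-filter-tabulate P? (f ∘ suc))
... | false = length-filter-tabulate P? (f ∘ suc)

foldr-⊔-map-constant : {A : Set} (f : A → ℕ) → (∀ x → f x ≡ d) →
                       ∀ x xs → foldr _⊔_ 0 (map f (x ∷ xs)) ≡ d
foldr-⊔-map-constant {d} f f≡d x []
  rewrite f≡d x = ℕ.⊔-identityʳ d
foldr-⊔-map-constant {d} f f≡d x (y ∷ ys)
  rewrite f≡d x | foldr-⊔-map-constant f f≡d y ys = ℕ.⊔-idem d

module _ (G : Graph n) where
  open Graph G using (Adj; adj?)

  degree≡count : ∀ v → degree G v ≡ count (adj? v)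
  degree≡count v = length-filter-tabulate (adj? v) id

  nonComplete⇒nonadjacent-pair : ¬ Complete G → ∃ λ x → ∃ λ y → x ≢ y × ¬ Adj x y
  nonComplete⇒nonadjacent-pair incomplete =
    let x , x-incomplete = Fin.¬∀⟶∃¬ n _ (λ x → Fin.all? (adjacent-if-distinct? x)) incomplete
        y , y-missed     = Fin.¬∀⟶∃¬ n _ (adjacent-if-distinct? x) x-incomplete
    in x , y , (λ x≡y → y-missed (λ x≢y → contradiction x≡y x≢y)) , (λ xy → y-missed (λ _ → xy))
    where
    adjacent-if-distinct? : ∀ x → Decidable (λ y → x ≢ y → Adj x y)
    adjacent-if-distinct? x y = ¬? (x Fin.≟ y) →-dec adj? x y

maxDegree-regular : (G : Graph (suc m)) → (∀ v → degree G v ≡ d) → maxDegree G ≡ d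
maxDegree-regular G regular = foldr-⊔-map-constant (degree G) regular zero (tabulate suc)

module _ (G : Graph n) (C : TotalColoring G k) where
  open Graph G using (Adj)
  open TotalColoring C

  ec-injective : ∀ {v u w} → Adj v u → Adj v w → ec v u ≡ ec v w → u ≡ w
  ec-injective {v} {u} {w} vu vw same with u Fin.≟ w
  ... | yes u≡w = u≡w
  ... | no  u≢w = contradiction same (ee v u w vu vw u≢w)

  monochromatic⇒nonadjacent : ∀ {u v} → vc u ≡ vc v → ¬ Adj u v
  monochromatic⇒nonadjacent same uv = vv _ _ uv same

module _ (G : Graph n) (regular : ∀ v → degree G v ≡ d) where
  open Graph G using (Adj; adj?; irrefl) renaming (sym to adj-sym)

  count-adj≡d : ∀ v → count (adj? v) ≡ d
  count-adj≡d v = trans (sym (degree≡count G v)) (regular v)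

  nonComplete-regular⇒2+d≤n : ¬ Complete G → 2 + d ≤ n
  nonComplete-regular⇒2+d≤n incomplete =
    let x , y , x≢y , x≁y = nonComplete⇒nonadjacent-pair G incomplete
    in subst (λ e → 2 + e ≤ n) (count-adj≡d x)
         (injective-missing-two⇒2+m≤k (enumerate (adj? x)) (enumerate-injective (adj? x)) x≢y
           (λ i eq → irrefl (subst (Adj x) eq (enumerate-∈ (adj? x) i)))
           (λ i eq → x≁y (subst (Adj x) eq (enumerate-∈ (adj? x) i))))

  module _ (C : TotalColoring G (suc d)) where
    open TotalColoring C

    -- The d edge colours at v and the colour of v are d + 1 distinct colours, hence all of them.
    sees-every-colour : ∀ v c → vc v ≢ c → ∃ λ u → Adj v u × ec v u ≡ c
    sees-every-colour v c vc≢c with Fin.any? (λ u → adj? v u ×-dec (ec v u Fin.≟ c))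
    ... | yes seen = seen
    ... | no  unseen = contradiction 2+d≤1+d ℕ.1+n≰n
      where
      neighbour : Fin (count (adj? v)) → Fin n
      neighbour = enumerate (adj? v)
      2+d≤1+d : 2 + d ≤ suc d
      2+d≤1+d = subst (λ e → 2 + e ≤ suc d) (count-adj≡d v)
        (injective-missing-two⇒2+m≤k (ec v ∘ neighbour)
          (λ same → enumerate-injective (adj? v)
            (ec-injective G C (enumerate-∈ (adj? v) _) (enumerate-∈ (adj? v) _) same))
          vc≢c
          (λ i → ev v (neighbour i) (enumerate-∈ (adj? v) i))
          (λ i eq → unseen (neighbour i , enumerate-∈ (adj? v) i , eq)))

    -- Pair every vertex outside the colour class {i, j} of c with the other end of its c-edge,
    -- and i with j.
    colourClass-pair⇒even : ∀ {c i j} → i ≢ j → vc i ≡ c → vc j ≡ c →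
                            (∀ w → w ≢ i → w ≢ j → vc w ≢ c) → 2 ∣ n
    colourClass-pair⇒even {c} {i} {j} i≢j vc-i vc-j only-i-j =
      fixedPointFree-involution⇒even τ τ-involutive τ-fixedPointFree
      where
      τ : Fin n → Fin n
      τ v with v Fin.≟ i | v Fin.≟ j
      ... | yes _   | _       = j
      ... | no _    | yes _   = i
      ... | no v≢i  | no v≢j  = proj₁ (sees-every-colour v c (only-i-j v v≢i v≢j))

      τ-i : τ i ≡ j
      τ-i with i Fin.≟ i
      ... | yes _   = refl
      ... | no i≢i  = contradiction refl i≢i

      τ-j : τ j ≡ i
      τ-j with j Fin.≟ i | j Fin.≟ j
      ... | yes j≡i | _       = contradiction (sym j≡i) i≢j
      ... | no _    | yes _   = refl
      ... | no _    | no j≢j  = contradiction refl j≢j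

      τ-c-edge : ∀ v → v ≢ i → v ≢ j → Adj v (τ v) × ec v (τ v) ≡ c
      τ-c-edge v v≢i v≢j with v Fin.≟ i | v Fin.≟ j
      ... | yes v≡i | _       = contradiction v≡i v≢i
      ... | no _    | yes v≡j = contradiction v≡j v≢j
      ... | no v≢i  | no v≢j  = proj₂ (sees-every-colour v c (only-i-j v v≢i v≢j))

      τ-back : ∀ {v u} → Adj v u → ec v u ≡ c → τ u ≡ v
      τ-back {v} {u} vu ec-vu =
        ec-injective G C (proj₁ τu-edge) (adj-sym vu) (trans (proj₂ τu-edge) (sym ec-uv))
        where
        ec-uv : ec u v ≡ c
        ec-uv = trans (ec-sym u v (adj-sym vu)) ec-vu
        vc-u≢c : vc u ≢ c
        vc-u≢c vc-u = ev u v (adj-sym vu) (trans ec-uv (sym vc-u))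
        τu-edge : Adj u (τ u) × ec u (τ u) ≡ c
        τu-edge = τ-c-edge u (λ u≡i → vc-u≢c (trans (cong vc u≡i) vc-i))
                             (λ u≡j → vc-u≢c (trans (cong vc u≡j) vc-j))

      τ-involutive : ∀ v → τ (τ v) ≡ v
      τ-involutive v with v Fin.≟ i | v Fin.≟ j
      ... | yes refl | _        = τ-j
      ... | no _     | yes refl = τ-i
      ... | no v≢i   | no v≢j   =
        uncurry τ-back (proj₂ (sees-every-colour v c (only-i-j v v≢i v≢j)))

      τ-fixedPointFree : ∀ v → τ v ≢ v
      τ-fixedPointFree v with v Fin.≟ i | v Fin.≟ j
      ... | yes refl | _        = i≢j ∘ sym
      ... | no _     | yes refl = i≢j
      ... | no v≢i   | no v≢j   = λ τv≡v → irrefl (subst (Adj v) τv≡v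
              (proj₁ (proj₂ (sees-every-colour v c (only-i-j v v≢i v≢j)))))

    odd-nonComplete⇒monochromatic-triple :
      ¬ 2 ∣ n → ¬ Complete G →
      ∃ λ u → ∃ λ v → ∃ λ w → u ≢ v × u ≢ w × v ≢ w × vc u ≡ vc v × vc u ≡ vc w
    odd-nonComplete⇒monochromatic-triple n-odd incomplete
      with Fin.pigeonhole (nonComplete-regular⇒2+d≤n incomplete) vc
    ... | i , j , i<j , vc-i≡vc-j
      with Fin.any? (λ w → ¬? (w Fin.≟ i) ×-dec ¬? (w Fin.≟ j) ×-dec (vc w Fin.≟ vc i))
    ... | yes (w , w≢i , w≢j , vc-w≡vc-i) =
      i , j , w , Fin.<⇒≢ i<j , w≢i ∘ sym , w≢j ∘ sym , vc-i≡vc-j , sym vc-w≡vc-i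
    ... | no no-third = contradiction
      (colourClass-pair⇒even (Fin.<⇒≢ i<j) refl (sym vc-i≡vc-j)
        (λ w w≢i w≢j vc-w≡vc-i → no-third (w , w≢i , w≢j , vc-w≡vc-i)))
      n-odd

module _ (H : FinGroup n) (G : Graph n) {S : Subset n} (cayley : IsCayleyGraphOf G H S) where
  open FinGroup H
  open IsGroup isGroup using (assoc)
  open Graph G using (Adj; adj?)

  private
    group : Group 0ℓ 0ℓ
    group = record { isGroup = isGroup }

  open GroupProperties group
    using (∙-cancelˡ; ⁻¹-injective; ⁻¹-anti-homo-//; //-rightDividesˡ; \\-leftDividesˡ)

  translate-adj : ∀ t {x y} → Adj x y → Adj (t ∙ x) (t ∙ y)
  translate-adj t {x} {y} xy with proj₁ (cayley x y) xy
  ... | s , s∈S , y≡xs =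
    proj₂ (cayley _ _) (s , s∈S , trans (cong (t ∙_) y≡xs) (sym (assoc t x s)))

  count-adj-≤ : ∀ g h → count (adj? g) ≤ count (adj? h)
  count-adj-≤ g h = injective⇒≤count (adj? h) (λ i → t ∙ enumerate (adj? g) i)
    (enumerate-injective (adj? g) ∘ ∙-cancelˡ t _ _)
    (λ i → subst (λ x → Adj x (t ∙ enumerate (adj? g) i)) (//-rightDividesˡ g h)
             (translate-adj t (enumerate-∈ (adj? g) i)))
    where
    t : Fin n
    t = h ∙ (g ⁻¹)

  Cayley-regular : ∀ g h → degree G g ≡ degree G h
  Cayley-regular g h = begin
    degree G g       ≡⟨ degree≡count G g ⟩
    count (adj? g)   ≡⟨ ℕ.≤-antisym (count-adj-≤ g h) (count-adj-≤ h g) ⟩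
    count (adj? h)   ≡⟨ degree≡count G h ⟨
    degree G h       ∎
    where open ≡-Reasoning

  module _ {K : Subset n} (K-clique : IsClique G K) where

    TranslatesContaining : Fin n → Pred (Fin n) 0ℓ
    TranslatesContaining a x = ((x ⁻¹) ∙ a) ∈ K

    translatesContaining? : ∀ a → Decidable (TranslatesContaining a)
    translatesContaining? a x = ((x ⁻¹) ∙ a) ∈? K

    ∣K∣≤count-translates : ∀ a → ∣ K ∣ ≤ count (translatesContaining? a)
    ∣K∣≤count-translates a =
      subst (_≤ count (translatesContaining? a)) (sym (∣p∣≡count K))
      (injective⇒≤count (translatesContaining? a) (λ i → a ∙ (element i ⁻¹))
        (enumerate-injective (_∈? K) ∘ ⁻¹-injective ∘ ∙-cancelˡ a _ _)
        (λ i → subst (_∈ K) (sym (translate-by i)) (enumerate-∈ (_∈? K) i)))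
      where
      element : Fin (count (_∈? K)) → Fin n
      element = enumerate (_∈? K)
      translate-by : ∀ i → ((a ∙ (element i ⁻¹)) ⁻¹) ∙ a ≡ element i
      translate-by i =
        trans (cong (_∙ a) (⁻¹-anti-homo-// a (element i))) (//-rightDividesˡ a (element i))

    -- A translate x K is again a clique, so it contains at most one of two non-adjacent vertices.
    translates-disjoint : ∀ {a b} → a ≢ b → ¬ Adj a b →
                          TranslatesContaining a ⊥ TranslatesContaining b
    translates-disjoint {a} {b} a≢b a≁b {x} (a∈xK , b∈xK) =
      a≁b (subst₂ Adj (\\-leftDividesˡ x a) (\\-leftDividesˡ x b)
        (translate-adj x (K-clique _ _ a∈xK b∈xK (a≢b ∘ ∙-cancelˡ (x ⁻¹) a b))))

    independent-triple⇒3∣K∣≤n : ∀ {u v w} → u ≢ v → u ≢ w → v ≢ w →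
                                ¬ Adj u v → ¬ Adj u w → ¬ Adj v w → 3 * ∣ K ∣ ≤ n
    independent-triple⇒3∣K∣≤n {u} {v} {w} u≢v u≢w v≢w u≁v u≁w v≁w = begin
      ∣ K ∣ + (∣ K ∣ + (∣ K ∣ + 0))
        ≤⟨ ℕ.+-mono-≤ (∣K∣≤count-translates u)
             (ℕ.+-mono-≤ (∣K∣≤count-translates v)
               (ℕ.≤-trans (ℕ.≤-reflexive (ℕ.+-identityʳ _)) (∣K∣≤count-translates w))) ⟩
      count (Tr? u) + (count (Tr? v) + count (Tr? w))
        ≤⟨ ℕ.+-monoʳ-≤ (count (Tr? u))
             (count-∪ (Tr? v) (Tr? w) (translates-disjoint v≢w v≁w)) ⟩
      count (Tr? u) + count (Tr? v ∪? Tr? w)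
        ≤⟨ count-∪ (Tr? u) (Tr? v ∪? Tr? w)
             (λ { (p , inj₁ q) → translates-disjoint u≢v u≁v (p , q)
                ; (p , inj₂ q) → translates-disjoint u≢w u≁w (p , q) }) ⟩
      count (Tr? u ∪? (Tr? v ∪? Tr? w))
        ≤⟨ count≤n (Tr? u ∪? (Tr? v ∪? Tr? w)) ⟩
      n ∎
      where
      open ℕ.≤-Reasoning
      Tr? : ∀ a → Decidable (TranslatesContaining a)
      Tr? = translatesContaining?

Cayley-degree≡maxDegree : (H : FinGroup n) (G : Graph n) {S : Subset n} →
                          IsCayleyGraphOf G H S → ∀ v → degree G v ≡ maxDegree G
Cayley-degree≡maxDegree {zero}  H G cayley ()
Cayley-degree≡maxDegree {suc _} H G cayley v = trans (Cayley-regular H G cayley v zero)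
  (sym (maxDegree-regular G (λ u → Cayley-regular H G cayley u zero)))

%2≡1⇒¬2∣ : n % 2 ≡ 1 → ¬ 2 ∣ n
%2≡1⇒¬2∣ {n} n%2≡1 2∣n = contradiction (trans (sym n%2≡1) (n∣m⇒m%n≡0 n 2 2∣n)) λ ()

theorem2p5 : (n : ℕ) (H : FinGroup n) (S : Subset n) (G : Graph n) →
    IsConnectionSet H S → IsCayleyGraphOf G H S →
    n % 2 ≡ 1 → ¬ Complete G →
    (ω : ℕ) → IsCliqueNumber G ω → n < 3 * ω →
    ¬ TypeI G
-- The connection-set conditions are implied by G being a simple graph.
theorem2p5 n H S G _ cayley n%2≡1 incomplete ω ((K , K-clique , ∣K∣≡ω) , _) n<3ω (C , _) =
  let u , v , w , u≢v , u≢w , v≢w , vc-u≡vc-v , vc-u≡vc-w =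
        odd-nonComplete⇒monochromatic-triple G (Cayley-degree≡maxDegree H G cayley) C
          (%2≡1⇒¬2∣ n%2≡1) incomplete
  in ℕ.<⇒≱ n<3ω (subst (λ k → 3 * k ≤ n) ∣K∣≡ω
       (independent-triple⇒3∣K∣≤n H G cayley K-clique u≢v u≢w v≢w
         (monochromatic⇒nonadjacent G C vc-u≡vc-v)
         (monochromatic⇒nonadjacent G C vc-u≡vc-w)
         (monochromatic⇒nonadjacent G C (trans (sym vc-u≡vc-v) vc-u≡vc-w))))
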